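{- For all positive integers $a$ and $k$, $C(a^k)=C(a)$.
   Context: For a word $u$ over the positive integers, $C(u)=\{w \mid uw\equiv wu\}$, where $w$ ranges over finite words over the positive integers and $\equiv$ is Knuth equivalence (equivalently, $P(uw)=P(wu)$ with $P$ the RSK insertion tableau). $a^k$ is the word consisting of $k$ copies of the letter $a$. -}

module Defs where

open import Data.Nat using (ℕ; _≤_; _<_)
open import Data.List using (List; []; _∷_; _++_; replicate)

-- Words over the alphabet of natural numbers (totally ordered by ≤).
-- The theorem restricts all letters to be positive via explicit hypotheses.
Word : Set
Word = List ℕ

data KnuthStep : Word → Word → Set where
  k1 : ∀ (u v : Word) {x y z : ℕ} → x ≤ y → y < z →
       KnuthStep (u ++ x ∷ z ∷ y ∷ v) (u ++ z ∷ x ∷ y ∷ v)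
  k2 : ∀ (u v : Word) {x y z : ℕ} → x < y → y ≤ z →
       KnuthStep (u ++ y ∷ x ∷ z ∷ v) (u ++ y ∷ z ∷ x ∷ v)

infix 4 _≡K_
data _≡K_ : Word → Word → Set where
  ≡K-refl  : ∀ {w} → w ≡K w
  ≡K-step  : ∀ {w w'} → KnuthStep w w' → w ≡K w'
  ≡K-sym   : ∀ {w w'} → w ≡K w' → w' ≡K w
  ≡K-trans : ∀ {w w' w''} → w ≡K w' → w' ≡K w'' → w ≡K w''

_∈C_ : Word → Word → Set
w ∈C u = (u ++ w) ≡K (w ++ u)

_^ʷ_ : ℕ → ℕ → Word
a ^ʷ k = replicate k a

{-# OPTIONS --safe #-}

-- C(a) ⊆ C(a^k) is immediate. Conversely, replace w by the reading word r of its insertion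
-- tableau, with first row R. Knuth moves preserve the lengths of weakly increasing subsequences
-- with letters in a given interval, and in r such a subsequence is no longer than the number of
-- letters of R in that interval. Comparing such subsequences of a^k r and r a^k shows first that
-- the tableau has at least as many letters a as R has letters ≤ a (the reverse inequality always
-- holds), which forces the letters ≤ a outside R to sit exactly above the letters < a; and then
-- that all letters of R are ≤ a. For such a tableau, row-inserting r into the row a bumps out the
-- higher rows unchanged and leaves the row R a, so a r ≡ r a.

module Submission where

open import Defs
open import Data.Nat using (ℕ; zero; suc; _<_; _≤_; _+_; z≤n; s≤s; z<s; _<?_; _≤?_)
open import Data.Nat.Properties
open import Data.List using (List; []; _∷_; [_]; _++_; replicate; length)
open import Data.List.Properties using (++-assoc; ++-identityʳ; length-replicate)
open import Data.List.Relation.Unary.All as All using (All; []; _∷_)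
import Data.List.Relation.Unary.All.Properties as Allₚ
open import Data.List.Relation.Unary.AllPairs using (AllPairs; []; _∷_)
open import Data.List.Relation.Binary.Pointwise as Pointwise using (Pointwise; []; _∷_)
open import Data.List.Membership.Propositional using (_∈_)
open import Data.List.Relation.Unary.Any using (here; there)
open import Data.Maybe using (Maybe; nothing; just)
open import Data.Product using (_×_; _,_; proj₁; proj₂; ∃-syntax; ∃₂; map₁; map₂)
open import Data.Sum using (_⊎_; inj₁; inj₂)
open import Data.Empty using (⊥; ⊥-elim)
open import Data.Unit using (⊤; tt)
open import Relation.Nullary using (Dec; yes; no)
open import Relation.Nullary.Decidable using (_×-dec_)
open import Relation.Binary using (IsEquivalence; Setoid)
open import Function.Bundles using (_⇔_; mk⇔; Equivalence)
import Function.Properties.Equivalence as ⇔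
open import Relation.Binary.PropositionalEquality as ≡ using (_≡_; refl; cong; subst; subst₂)
import Relation.Binary.Reasoning.Setoid as SetoidReasoning

≡K-isEquivalence : IsEquivalence _≡K_
≡K-isEquivalence = record { refl = ≡K-refl ; sym = ≡K-sym ; trans = ≡K-trans }

≡K-setoid : Setoid _ _
≡K-setoid = record { isEquivalence = ≡K-isEquivalence }

module ≡K-Reasoning = SetoidReasoning ≡K-setoid

≡⇒≡K : ∀ {u v} → u ≡ v → u ≡K v
≡⇒≡K refl = ≡K-refl

knuthStep-++⁺ˡ : ∀ p {u v} → KnuthStep u v → KnuthStep (p ++ u) (p ++ v)
knuthStep-++⁺ˡ p (k1 u v x≤y y<z) = subst₂ KnuthStep (++-assoc p u _) (++-assoc p u _) (k1 (p ++ u) v x≤y y<z)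
knuthStep-++⁺ˡ p (k2 u v x<y y≤z) = subst₂ KnuthStep (++-assoc p u _) (++-assoc p u _) (k2 (p ++ u) v x<y y≤z)

knuthStep-++⁺ʳ : ∀ s {u v} → KnuthStep u v → KnuthStep (u ++ s) (v ++ s)
knuthStep-++⁺ʳ s (k1 u v x≤y y<z) =
  subst₂ KnuthStep (≡.sym (++-assoc u _ s)) (≡.sym (++-assoc u _ s)) (k1 u (v ++ s) x≤y y<z)
knuthStep-++⁺ʳ s (k2 u v x<y y≤z) =
  subst₂ KnuthStep (≡.sym (++-assoc u _ s)) (≡.sym (++-assoc u _ s)) (k2 u (v ++ s) x<y y≤z)

++⁺ˡ : ∀ p {u v} → u ≡K v → p ++ u ≡K p ++ v
++⁺ˡ p ≡K-refl         = ≡K-refl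
++⁺ˡ p (≡K-step s)     = ≡K-step (knuthStep-++⁺ˡ p s)
++⁺ˡ p (≡K-sym e)      = ≡K-sym (++⁺ˡ p e)
++⁺ˡ p (≡K-trans e e′) = ≡K-trans (++⁺ˡ p e) (++⁺ˡ p e′)

++⁺ʳ : ∀ s {u v} → u ≡K v → u ++ s ≡K v ++ s
++⁺ʳ s ≡K-refl         = ≡K-refl
++⁺ʳ s (≡K-step st)    = ≡K-step (knuthStep-++⁺ʳ s st)
++⁺ʳ s (≡K-sym e)      = ≡K-sym (++⁺ʳ s e)
++⁺ʳ s (≡K-trans e e′) = ≡K-trans (++⁺ʳ s e) (++⁺ʳ s e′)

∈C-resp-≡K : ∀ {u w w′} → w ≡K w′ → w ∈C u → w′ ∈C u
∈C-resp-≡K {u} {w} {w′} w≡w′ w∈C = begin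
  u ++ w′  ≈⟨ ++⁺ˡ u w≡w′ ⟨
  u ++ w   ≈⟨ w∈C ⟩
  w ++ u   ≈⟨ ++⁺ʳ u w≡w′ ⟩
  w′ ++ u  ∎
  where open ≡K-Reasoning

∈C-++ : ∀ {u v w} → w ∈C u → w ∈C v → w ∈C (u ++ v)
∈C-++ {u} {v} {w} w∈Cu w∈Cv = begin
  (u ++ v) ++ w  ≡⟨ ++-assoc u v w ⟩
  u ++ v ++ w    ≈⟨ ++⁺ˡ u w∈Cv ⟩
  u ++ w ++ v    ≡⟨ ++-assoc u w v ⟨
  (u ++ w) ++ v  ≈⟨ ++⁺ʳ v w∈Cu ⟩
  (w ++ u) ++ v  ≡⟨ ++-assoc w u v ⟩
  w ++ u ++ v    ∎
  where open ≡K-Reasoning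

∈C-replicate : ∀ {a w} k → w ∈C [ a ] → w ∈C (a ^ʷ k)
∈C-replicate zero    _   = ≡⇒≡K (≡.sym (++-identityʳ _))
∈C-replicate (suc k) w∈C = ∈C-++ {[ _ ]} w∈C (∈C-replicate k w∈C)

-- Row insertion and tableaux

Sorted : Word → Set
Sorted = AllPairs _≤_

-- Stacked R S: the row S may sit directly on top of the row R in a semistandard tableau.
data Stacked : Word → Word → Set where
  []  : ∀ {R} → Stacked R []
  _∷_ : ∀ {x y R S} → x < y → Stacked R S → Stacked (x ∷ R) (y ∷ S)

rowInsert : Word → ℕ → Word × Maybe ℕ
rowInsert []      x = [ x ] , nothing
rowInsert (r ∷ R) x with x <? r
... | yes _ = x ∷ R , just r
... | no  _ = map₁ (r ∷_) (rowInsert R x)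

rowInsert-bumps-greater : ∀ R {x R′ y} → rowInsert R x ≡ (R′ , just y) → x < y
rowInsert-bumps-greater (r ∷ R) {x} eq with x <? r
rowInsert-bumps-greater (r ∷ R) refl | yes x<r = x<r
... | no _ with rowInsert R x in eq′
rowInsert-bumps-greater (r ∷ R) refl | no _ | _ , just _ = rowInsert-bumps-greater R eq′

rowInsert-appends : ∀ R {x R′} → rowInsert R x ≡ (R′ , nothing) → R′ ≡ R ++ [ x ]
rowInsert-appends []      refl = refl
rowInsert-appends (r ∷ R) {x} eq with x <? r
... | no _ with rowInsert R x in eq′
rowInsert-appends (r ∷ R) refl | no _ | _ , nothing = cong (r ∷_) (rowInsert-appends R eq′)

rowInsert-All : ∀ {P : ℕ → Set} R {x} → All P R → P x → All P (proj₁ (rowInsert R x))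
rowInsert-All []      []        px = px ∷ []
rowInsert-All (r ∷ R) {x} (pr ∷ pR) px with x <? r
... | yes _ = px ∷ pR
... | no  _ = pr ∷ rowInsert-All R pR px

rowInsert-sorted : ∀ R {x} → Sorted R → Sorted (proj₁ (rowInsert R x))
rowInsert-sorted []      []             = [] ∷ []
rowInsert-sorted (r ∷ R) {x} (r≤R ∷ sR) with x <? r
... | yes x<r = All.map (≤-trans (<⇒≤ x<r)) r≤R ∷ sR
... | no  x≮r = rowInsert-All R r≤R (≮⇒≥ x≮r) ∷ rowInsert-sorted R sR

rowInsert-decreases : ∀ R {x R′ y} → rowInsert R x ≡ (R′ , just y) → Pointwise _≤_ R′ R
rowInsert-decreases (r ∷ R) {x} eq with x <? r
rowInsert-decreases (r ∷ R) refl | yes x<r = <⇒≤ x<r ∷ Pointwise.refl ≤-refl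
... | no _ with rowInsert R x in eq′
rowInsert-decreases (r ∷ R) refl | no _ | _ , just _ = ≤-refl ∷ rowInsert-decreases R eq′

stacked-≥ : ∀ {R′ R S} → Pointwise _≤_ R′ R → Stacked R S → Stacked R′ S
stacked-≥ _             []          = []
stacked-≥ (r′≤r ∷ R′≤R) (r<s ∷ R<S) = ≤-<-trans r′≤r r<s ∷ stacked-≥ R′≤R R<S

stacked-∷ʳ : ∀ {R S} x → Stacked R S → Stacked (R ++ [ x ]) S
stacked-∷ʳ x []          = []
stacked-∷ʳ x (r<s ∷ R<S) = r<s ∷ stacked-∷ʳ x R<S

rowInsert-stacked : ∀ R S {x R′ y} → Stacked R S → rowInsert R x ≡ (R′ , just y) →
                    Stacked R′ (proj₁ (rowInsert S y))
rowInsert-stacked (r ∷ R) S {x} R<S eq with x <? r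
rowInsert-stacked (r ∷ R) []      R<S         refl | yes x<r = x<r ∷ []
rowInsert-stacked (r ∷ R) (s ∷ S) (r<s ∷ R<S) refl | yes x<r with r <? s
... | yes _   = x<r ∷ R<S
... | no  r≮s = ⊥-elim (r≮s r<s)
rowInsert-stacked (r ∷ R) S {x} R<S eq | no x≮r with rowInsert R x in eq′
rowInsert-stacked (r ∷ R) [] R<S refl | no x≮r | _ , just y =
  ≤-<-trans (≮⇒≥ x≮r) (rowInsert-bumps-greater R eq′) ∷ []
rowInsert-stacked (r ∷ R) (s ∷ S) (r<s ∷ R<S) refl | no x≮r | _ , just y with y <? s
... | yes _ =
  ≤-<-trans (≮⇒≥ x≮r) (rowInsert-bumps-greater R eq′) ∷ stacked-≥ (rowInsert-decreases R eq′) R<S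
... | no  _ = r<s ∷ rowInsert-stacked R S R<S eq′

rowInsert-head : ∀ R {x r R′ y} → All (r ≤_) R → r ≤ x → rowInsert R x ≡ (R′ , just y) →
                 ∃₂ λ z R″ → R′ ≡ z ∷ R″ × r ≤ z × z < y
rowInsert-head (r₀ ∷ R) {x} r≤R r≤x eq with x <? r₀
rowInsert-head (r₀ ∷ R) r≤R r≤x refl | yes x<r₀ = _ , _ , refl , r≤x , x<r₀
... | no x≮r₀ with rowInsert R x in eq′
rowInsert-head (r₀ ∷ R) (r≤r₀ ∷ _) r≤x refl | no x≮r₀ | _ , just _ =
  _ , _ , refl , r≤r₀ , ≤-<-trans (≮⇒≥ x≮r₀) (rowInsert-bumps-greater R eq′)

slide-left : ∀ {x r} R → x < r → Sorted (r ∷ R) → r ∷ R ++ [ x ] ≡K r ∷ x ∷ R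
slide-left []      x<r _                   = ≡K-refl
slide-left (s ∷ R) x<r ((r≤s ∷ _) ∷ sR) =
  ≡K-trans (++⁺ˡ [ _ ] (slide-left R (<-≤-trans x<r r≤s) sR)) (≡K-sym (≡K-step (k2 [] R x<r r≤s)))

rowInsert-≡K : ∀ R {x R′ y} → Sorted R → rowInsert R x ≡ (R′ , just y) → R ++ [ x ] ≡K y ∷ R′
rowInsert-≡K (r ∷ R) {x} sR eq with x <? r
rowInsert-≡K (r ∷ R) sR refl | yes x<r = slide-left R x<r sR
... | no x≮r with rowInsert R x in eq′
rowInsert-≡K (r ∷ R) (r≤R ∷ sR) refl | no x≮r | _ , just y
  with rowInsert-head R r≤R (≮⇒≥ x≮r) eq′
... | _ , R″ , refl , r≤z , z<y =
  ≡K-trans (++⁺ˡ [ r ] (rowInsert-≡K R sR eq′)) (≡K-step (k1 [] R″ r≤z z<y))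

Tableau : Set
Tableau = List Word

firstRow : Tableau → Word
firstRow []      = []
firstRow (R ∷ _) = R

-- Rows are listed from the first (longest) one upwards.
data IsTableau : Tableau → Set where
  []  : IsTableau []
  row : ∀ {R T} → Sorted R → Stacked R (firstRow T) → IsTableau T → IsTableau (R ∷ T)

firstRow-sorted : ∀ {R T} → IsTableau (R ∷ T) → Sorted R
firstRow-sorted (row sR _ _) = sR

reading : Tableau → Word
reading []      = []
reading (R ∷ T) = reading T ++ R

insert : Tableau → ℕ → Tableau
insert []      x = [ [ x ] ]
insert (R ∷ T) x with rowInsert R x
... | R′ , nothing = R′ ∷ T
... | R′ , just y  = R′ ∷ insert T y

insertAll : Tableau → Word → Tableau
insertAll T []       = T
insertAll T (x ∷ xs) = insertAll (insert T x) xs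

P : Word → Tableau
P = insertAll []

firstRow-insert : ∀ T x → firstRow (insert T x) ≡ proj₁ (rowInsert (firstRow T) x)
firstRow-insert []      x = refl
firstRow-insert (R ∷ T) x with rowInsert R x
... | _ , nothing = refl
... | _ , just _  = refl

insert-isTableau : ∀ T {x} → IsTableau T → IsTableau (insert T x)
insert-isTableau []      []                = row ([] ∷ []) [] []
insert-isTableau (R ∷ T) {x} (row sR R<T tT) with rowInsert R x in eq | rowInsert-sorted R {x} sR
... | R′ , nothing | sR′ =
  row sR′ (subst (λ R′ → Stacked R′ (firstRow T)) (≡.sym (rowInsert-appends R eq)) (stacked-∷ʳ x R<T)) tT
... | R′ , just y  | sR′ =
  row sR′ (subst (Stacked R′) (≡.sym (firstRow-insert T y)) (rowInsert-stacked R (firstRow T) R<T eq))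
      (insert-isTableau T tT)

insertAll-isTableau : ∀ T xs → IsTableau T → IsTableau (insertAll T xs)
insertAll-isTableau T []       tT = tT
insertAll-isTableau T (x ∷ xs) tT = insertAll-isTableau (insert T x) xs (insert-isTableau T tT)

reading-insert : ∀ T {x} → IsTableau T → reading T ++ [ x ] ≡K reading (insert T x)
reading-insert []      _                 = ≡K-refl
reading-insert (R ∷ T) {x} (row sR _ tT) with rowInsert R x in eq
... | R′ , nothing = ≡⇒≡K (begin
  (reading T ++ R) ++ [ x ]  ≡⟨ ++-assoc (reading T) R [ x ] ⟩
  reading T ++ R ++ [ x ]    ≡⟨ cong (reading T ++_) (rowInsert-appends R eq) ⟨
  reading T ++ R′            ∎)
  where open ≡.≡-Reasoning
... | R′ , just y  = begin
  (reading T ++ R) ++ [ x ]   ≡⟨ ++-assoc (reading T) R [ x ] ⟩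
  reading T ++ R ++ [ x ]     ≈⟨ ++⁺ˡ (reading T) (rowInsert-≡K R sR eq) ⟩
  reading T ++ y ∷ R′         ≡⟨ ++-assoc (reading T) [ y ] R′ ⟨
  (reading T ++ [ y ]) ++ R′  ≈⟨ ++⁺ʳ R′ (reading-insert T tT) ⟩
  reading (insert T y) ++ R′  ∎
  where open ≡K-Reasoning

reading-insertAll : ∀ T xs → IsTableau T → reading T ++ xs ≡K reading (insertAll T xs)
reading-insertAll T []       _  = ≡⇒≡K (++-identityʳ (reading T))
reading-insertAll T (x ∷ xs) tT = begin
  reading T ++ x ∷ xs                  ≡⟨ ++-assoc (reading T) [ x ] xs ⟨
  (reading T ++ [ x ]) ++ xs           ≈⟨ ++⁺ʳ xs (reading-insert T tT) ⟩
  reading (insert T x) ++ xs           ≈⟨ reading-insertAll (insert T x) xs (insert-isTableau T tT) ⟩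
  reading (insertAll (insert T x) xs)  ∎
  where open ≡K-Reasoning

P-isTableau : ∀ w → IsTableau (P w)
P-isTableau w = insertAll-isTableau [] w []

≡K-reading-P : ∀ w → w ≡K reading (P w)
≡K-reading-P w = reading-insertAll [] w []

-- Weakly increasing subsequences

inRange? : ∀ m h x → Dec (m ≤ x × x < h)
inRange? m h x = (m ≤? x) ×-dec (x <? h)

count : ℕ → ℕ → Word → ℕ
count m h []      = 0
count m h (x ∷ u) with inRange? m h x
... | yes _ = suc (count m h u)
... | no  _ = count m h u

count-++ : ∀ m h u v → count m h (u ++ v) ≡ count m h u + count m h v
count-++ m h []      v = refl
count-++ m h (x ∷ u) v with inRange? m h x
... | yes _ = cong suc (count-++ m h u v)
... | no  _ = count-++ m h u v

count-split : ∀ {m j h} u → m ≤ j → j ≤ h → count m j u + count j h u ≡ count m h u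
count-split []      m≤j j≤h = refl
count-split {m} {j} {h} (x ∷ u) m≤j j≤h with inRange? m j x | inRange? j h x | inRange? m h x
... | yes _           | no _            | yes _           = cong suc (count-split u m≤j j≤h)
... | no _            | yes _           | yes _           = ≡.trans (+-suc _ _) (cong suc (count-split u m≤j j≤h))
... | no _            | no _            | no _            = count-split u m≤j j≤h
... | yes (_ , x<j)   | yes (j≤x , _)   | _               = ⊥-elim (<⇒≱ x<j j≤x)
... | yes (m≤x , x<j) | no _            | no ∉            = ⊥-elim (∉ (m≤x , <-≤-trans x<j j≤h))
... | no _            | yes (j≤x , x<h) | no ∉            = ⊥-elim (∉ (≤-trans m≤j j≤x , x<h))
... | no ∉ˡ           | no ∉ʳ           | yes (m≤x , x<h) =
  ⊥-elim (∉ʳ (≮⇒≥ (λ x<j → ∉ˡ (m≤x , x<j)) , x<h))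

count-∈ : ∀ {m h e} u → m ≤ e → e < h → e ∈ u → 0 < count m h u
count-∈ {m} {h} (x ∷ u) m≤e e<h e∈u with inRange? m h x
... | yes _ = z<s
count-∈ (x ∷ u) m≤e e<h (here refl)  | no ∉ = ⊥-elim (∉ (m≤e , e<h))
count-∈ (x ∷ u) m≤e e<h (there e∈u) | no _ = count-∈ u m≤e e<h e∈u

count-lower : ∀ {m m′ h} u → m ≤ m′ → All (m′ ≤_) u → count m′ h u ≡ count m h u
count-lower []      _    []                = refl
count-lower {m} {m′} {h} (x ∷ u) m≤m′ (m′≤x ∷ m′≤u) with inRange? m′ h x | inRange? m h x
... | yes _         | yes _         = cong suc (count-lower u m≤m′ m′≤u)
... | no  _         | no  _         = count-lower u m≤m′ m′≤u
... | yes (_ , x<h) | no ∉          = ⊥-elim (∉ (≤-trans m≤m′ m′≤x , x<h))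
... | no ∉          | yes (_ , x<h) = ⊥-elim (∉ (m′≤x , x<h))

count-all≥ : ∀ {m h} u → All (h ≤_) u → count m h u ≡ 0
count-all≥         []      []          = refl
count-all≥ {m} {h} (x ∷ u) (h≤x ∷ h≤u) with inRange? m h x
... | yes (_ , x<h) = ⊥-elim (<⇒≱ x<h h≤x)
... | no  _         = count-all≥ u h≤u

stacked-count : ∀ {R S} v → Stacked R S → count 0 (suc v) S ≤ count 0 v R
stacked-count v []                    = z≤n
stacked-count v (_∷_ {x} {y} x<y R<S) with inRange? 0 (suc v) y | inRange? 0 v x
... | yes _               | yes _ = s≤s (stacked-count v R<S)
... | no  _               | yes _ = m≤n⇒m≤1+n (stacked-count v R<S)
... | no  _               | no  _ = stacked-count v R<S
... | yes (_ , s≤s y≤v) | no ∉  = ⊥-elim (∉ (z≤n , <-≤-trans x<y y≤v))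

-- Incr h m u n: u has a weakly increasing subsequence of length n with letters in [m , h).
data Incr (h : ℕ) : ℕ → Word → ℕ → Set where
  []   : ∀ {m u} → Incr h m u 0
  skip : ∀ {m x u n} → Incr h m u n → Incr h m (x ∷ u) n
  keep : ∀ {m x u n} → m ≤ x → x < h → Incr h x u n → Incr h m (x ∷ u) (suc n)

incr-lower : ∀ {h m m′ u n} → m ≤ m′ → Incr h m′ u n → Incr h m u n
incr-lower _    []                = []
incr-lower m≤m′ (skip d)          = skip (incr-lower m≤m′ d)
incr-lower m≤m′ (keep m′≤x x<h d) = keep (≤-trans m≤m′ m′≤x) x<h d

incr-raise : ∀ {h h′ m u n} → h ≤ h′ → Incr h m u n → Incr h′ m u n
incr-raise _    []              = []
incr-raise h≤h′ (skip d)        = skip (incr-raise h≤h′ d)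
incr-raise h≤h′ (keep m≤x x<h d) = keep m≤x (<-≤-trans x<h h≤h′) (incr-raise h≤h′ d)

incr-length : ∀ {h m u n} → Incr h m u n → n ≤ length u
incr-length []           = z≤n
incr-length (skip d)     = m≤n⇒m≤1+n (incr-length d)
incr-length (keep _ _ d) = s≤s (incr-length d)

incr-≤-count : ∀ {h m m′ u n} → m ≤ m′ → Incr h m′ u n → n ≤ count m h u
incr-≤-count _ [] = z≤n
incr-≤-count {h} {m} {u = x ∷ u} m≤m′ (skip d) with inRange? m h x
... | yes _ = m≤n⇒m≤1+n (incr-≤-count m≤m′ d)
... | no  _ = incr-≤-count m≤m′ d
incr-≤-count {h} {m} {u = x ∷ u} m≤m′ (keep m′≤x x<h d) with inRange? m h x
... | yes _ = s≤s (incr-≤-count (≤-trans m≤m′ m′≤x) d)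
... | no ∉  = ⊥-elim (∉ (≤-trans m≤m′ m′≤x , x<h))

incr-++⁺ˡ : ∀ {h m n} u {v} → Incr h m v n → Incr h m (u ++ v) n
incr-++⁺ˡ []      d = d
incr-++⁺ˡ (x ∷ u) d = skip (incr-++⁺ˡ u d)

incr-++ : ∀ {h m v₀ u v n₁ n₂} → m ≤ v₀ → v₀ < h →
          Incr (suc v₀) m u n₁ → Incr h v₀ v n₂ → Incr h m (u ++ v) (n₁ + n₂)
incr-++ {u = u} m≤v₀ _ [] d₂ = incr-++⁺ˡ u (incr-lower m≤v₀ d₂)
incr-++ m≤v₀ v₀<h (skip d₁) d₂ = skip (incr-++ m≤v₀ v₀<h d₁ d₂)
incr-++ _ v₀<h (keep m≤x (s≤s x≤v₀) d₁) d₂ =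
  keep m≤x (≤-<-trans x≤v₀ v₀<h) (incr-++ x≤v₀ v₀<h d₁ d₂)

incr-split : ∀ {h} u {v m n} → m < h → Incr h m (u ++ v) n →
  ∃[ v₀ ] ∃₂ λ n₁ n₂ → m ≤ v₀ × v₀ < h ×
                       Incr (suc v₀) m u n₁ × Incr h v₀ v n₂ × n ≡ n₁ + n₂
incr-split []      {m = m} m<h d  = m , 0 , _ , ≤-refl , m<h , [] , d , refl
incr-split (x ∷ u) {m = m} m<h [] = m , 0 , 0 , ≤-refl , m<h , [] , [] , refl
incr-split (x ∷ u) m<h (skip d) with incr-split u m<h d
... | v₀ , n₁ , n₂ , m≤v₀ , v₀<h , d₁ , d₂ , eq =
  v₀ , n₁ , n₂ , m≤v₀ , v₀<h , skip d₁ , d₂ , eq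
incr-split (x ∷ u) m<h (keep m≤x x<h d) with incr-split u x<h d
... | v₀ , n₁ , n₂ , x≤v₀ , v₀<h , d₁ , d₂ , eq =
  v₀ , suc n₁ , n₂ , ≤-trans m≤x x≤v₀ , v₀<h , keep m≤x (s≤s x≤v₀) d₁ , d₂ , cong suc eq

incr-sorted : ∀ {h m} R → Sorted R → Incr h m R (count m h R)
incr-sorted []      []                  = []
incr-sorted {h} {m} (x ∷ R) (x≤R ∷ sR) with inRange? m h x
... | yes (m≤x , x<h) = keep m≤x x<h (subst (Incr h x R) (count-lower R m≤x x≤R) (incr-sorted R sR))
... | no  _           = skip (incr-sorted R sR)

incr-letter : ∀ a u → Incr (suc a) a u (count a (suc a) u)
incr-letter a []      = []
incr-letter a (x ∷ u) with inRange? a (suc a) x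
... | yes (a≤x , s≤s x≤a) = keep a≤x (s≤s x≤a) (incr-lower x≤a (incr-letter a u))
... | no  _               = skip (incr-letter a u)

incr-replicate : ∀ {h a} k → a < h → Incr h a (replicate k a) k
incr-replicate zero    _   = []
incr-replicate (suc k) a<h = keep ≤-refl a<h (incr-replicate k a<h)

incr-replicate-below : ∀ {h m a} k {n} → a < m → Incr h m (replicate k a) n → n ≡ 0
incr-replicate-below zero    _   []             = refl
incr-replicate-below (suc k) _   []             = refl
incr-replicate-below (suc k) a<m (skip d)       = incr-replicate-below k a<m d
incr-replicate-below (suc k) a<m (keep m≤a _ _) = ⊥-elim (<⇒≱ a<m m≤a)

incr-replicate-++ : ∀ k {a h m v n} → Incr h m (replicate k a ++ v) n →
                    Incr h m v n ⊎ ∃[ n₂ ] n ≤ k + n₂ × Incr h a v n₂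
incr-replicate-++ zero    d        = inj₁ d
incr-replicate-++ (suc k) []       = inj₁ []
incr-replicate-++ (suc k) (skip d) with incr-replicate-++ k d
... | inj₁ d′              = inj₁ d′
... | inj₂ (n₂ , n≤ , d₂) = inj₂ (n₂ , m≤n⇒m≤1+n n≤ , d₂)
incr-replicate-++ (suc k) (keep _ _ d) with incr-replicate-++ k d
... | inj₁ d₂              = inj₂ (_ , s≤s (m≤n+m _ k) , d₂)
... | inj₂ (n₂ , n≤ , d₂) = inj₂ (n₂ , s≤s n≤ , d₂)

incr-++-replicate : ∀ u {k a h m n} → m < h → Incr h m (u ++ replicate k a) n →
                    Incr h m u n ⊎ ∃[ n₁ ] n ≤ n₁ + k × Incr (suc a) m u n₁
incr-++-replicate u {k} {a} m<h d with incr-split u m<h d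
... | v₀ , n₁ , n₂ , _ , v₀<h , d₁ , d₂ , refl with v₀ ≤? a
...   | yes v₀≤a = inj₂ (n₁ , +-monoʳ-≤ n₁ (≤-trans (incr-length d₂) (≤-reflexive (length-replicate k)))
                      , incr-raise (s≤s v₀≤a) d₁)
...   | no  v₀≰a rewrite incr-replicate-below k (≰⇒> v₀≰a) d₂ | +-identityʳ n₁ =
  inj₁ (incr-raise v₀<h d₁)

module _ {h : ℕ} where

  k1-forward : ∀ {x y z v m n} → x ≤ y → y < z → Incr h m (x ∷ z ∷ y ∷ v) n → Incr h m (z ∷ x ∷ y ∷ v) n
  k1-forward x≤y y<z []                                      = []
  k1-forward x≤y y<z (skip [])                               = []
  k1-forward x≤y y<z (skip (skip d))                         = skip (skip d)
  k1-forward x≤y y<z (skip (keep m≤z z<h d))                 = keep m≤z z<h (skip d)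
  k1-forward x≤y y<z (keep m≤x x<h [])                       = skip (keep m≤x x<h [])
  k1-forward x≤y y<z (keep m≤x x<h (skip d))                 = skip (keep m≤x x<h d)
  k1-forward x≤y y<z (keep m≤x x<h (keep _ z<h []))          = skip (keep m≤x x<h (keep x≤y (<-trans y<z z<h) []))
  k1-forward x≤y y<z (keep m≤x x<h (keep _ z<h (skip d)))    =
    skip (keep m≤x x<h (keep x≤y (<-trans y<z z<h) (incr-lower (<⇒≤ y<z) d)))
  k1-forward x≤y y<z (keep m≤x x<h (keep _ _ (keep z≤y _ _))) = ⊥-elim (<⇒≱ y<z z≤y)

  k1-backward : ∀ {x y z v m n} → x ≤ y → y < z → Incr h m (z ∷ x ∷ y ∷ v) n → Incr h m (x ∷ z ∷ y ∷ v) n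
  k1-backward x≤y y<z []                                = []
  k1-backward x≤y y<z (skip [])                         = []
  k1-backward x≤y y<z (skip (skip d))                   = skip (skip d)
  k1-backward x≤y y<z (skip (keep m≤x x<h d))           = keep m≤x x<h (skip d)
  k1-backward x≤y y<z (keep m≤z z<h [])                 = skip (keep m≤z z<h [])
  k1-backward x≤y y<z (keep m≤z z<h (skip []))          = skip (keep m≤z z<h [])
  k1-backward x≤y y<z (keep m≤z z<h (skip (skip d)))    = skip (keep m≤z z<h (skip d))
  k1-backward x≤y y<z (keep _ _ (skip (keep z≤y _ _)))  = ⊥-elim (<⇒≱ y<z z≤y)
  k1-backward x≤y y<z (keep _ _ (keep z≤x _ _))         = ⊥-elim (<⇒≱ (≤-<-trans x≤y y<z) z≤x)

  k2-forward : ∀ {x y z v m n} → x < y → y ≤ z → Incr h m (y ∷ x ∷ z ∷ v) n → Incr h m (y ∷ z ∷ x ∷ v) n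
  k2-forward x<y y≤z []                                    = []
  k2-forward x<y y≤z (skip [])                             = []
  k2-forward x<y y≤z (skip (skip []))                      = []
  k2-forward x<y y≤z (skip (skip (skip d)))                = skip (skip (skip d))
  k2-forward x<y y≤z (skip (skip (keep m≤z z<h d)))        = skip (keep m≤z z<h (skip d))
  k2-forward x<y y≤z (skip (keep m≤x x<h []))              = skip (skip (keep m≤x x<h []))
  k2-forward x<y y≤z (skip (keep m≤x x<h (skip d)))        = skip (skip (keep m≤x x<h d))
  k2-forward x<y y≤z (skip (keep m≤x _ (keep _ z<h d)))    =
    keep (≤-trans m≤x (<⇒≤ x<y)) (≤-<-trans y≤z z<h) (keep y≤z z<h (skip d))
  k2-forward x<y y≤z (keep m≤y y<h [])                     = keep m≤y y<h []
  k2-forward x<y y≤z (keep m≤y y<h (skip []))              = keep m≤y y<h []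
  k2-forward x<y y≤z (keep m≤y y<h (skip (skip d)))        = keep m≤y y<h (skip (skip d))
  k2-forward x<y y≤z (keep m≤y y<h (skip (keep y≤z′ z<h d))) = keep m≤y y<h (keep y≤z′ z<h (skip d))
  k2-forward x<y y≤z (keep _ _ (keep y≤x _ _))             = ⊥-elim (<⇒≱ x<y y≤x)

  k2-backward : ∀ {x y z v m n} → x < y → y ≤ z → Incr h m (y ∷ z ∷ x ∷ v) n → Incr h m (y ∷ x ∷ z ∷ v) n
  k2-backward x<y y≤z []                                        = []
  k2-backward x<y y≤z (skip [])                                 = []
  k2-backward x<y y≤z (skip (skip []))                          = []
  k2-backward x<y y≤z (skip (skip (skip d)))                    = skip (skip (skip d))
  k2-backward x<y y≤z (skip (skip (keep m≤x x<h d)))            = skip (keep m≤x x<h (skip d))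
  k2-backward x<y y≤z (skip (keep m≤z z<h []))                  = skip (skip (keep m≤z z<h []))
  k2-backward x<y y≤z (skip (keep m≤z z<h (skip d)))            = skip (skip (keep m≤z z<h d))
  k2-backward x<y y≤z (skip (keep _ _ (keep z≤x _ _)))          = ⊥-elim (<⇒≱ (<-≤-trans x<y y≤z) z≤x)
  k2-backward x<y y≤z (keep m≤y y<h [])                         = keep m≤y y<h []
  k2-backward x<y y≤z (keep m≤y y<h (skip []))                  = keep m≤y y<h []
  k2-backward x<y y≤z (keep m≤y y<h (skip (skip d)))            = keep m≤y y<h (skip (skip d))
  k2-backward x<y y≤z (keep _ _ (skip (keep y≤x _ _)))          = ⊥-elim (<⇒≱ x<y y≤x)
  k2-backward x<y y≤z (keep m≤y y<h (keep y≤z′ z<h []))         = keep m≤y y<h (skip (keep y≤z′ z<h []))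
  k2-backward x<y y≤z (keep m≤y y<h (keep y≤z′ z<h (skip d)))   = keep m≤y y<h (skip (keep y≤z′ z<h d))
  k2-backward x<y y≤z (keep _ _ (keep _ _ (keep z≤x _ _)))      = ⊥-elim (<⇒≱ (<-≤-trans x<y y≤z) z≤x)

  incr-under-prefix : ∀ {s s′} → (∀ {m n} → Incr h m s n → Incr h m s′ n) →
                      ∀ p {m n} → Incr h m (p ++ s) n → Incr h m (p ++ s′) n
  incr-under-prefix f []      d                = f d
  incr-under-prefix f (x ∷ p) []               = []
  incr-under-prefix f (x ∷ p) (skip d)         = skip (incr-under-prefix f p d)
  incr-under-prefix f (x ∷ p) (keep m≤x x<h d) = keep m≤x x<h (incr-under-prefix f p d)

  incr-⇔-step : ∀ {u v m n} → KnuthStep u v → Incr h m u n ⇔ Incr h m v n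
  incr-⇔-step (k1 p _ x≤y y<z) =
    mk⇔ (incr-under-prefix (k1-forward x≤y y<z) p) (incr-under-prefix (k1-backward x≤y y<z) p)
  incr-⇔-step (k2 p _ x<y y≤z) =
    mk⇔ (incr-under-prefix (k2-forward x<y y≤z) p) (incr-under-prefix (k2-backward x<y y≤z) p)

  incr-⇔ : ∀ {u v m n} → u ≡K v → Incr h m u n ⇔ Incr h m v n
  incr-⇔ ≡K-refl         = ⇔.refl
  incr-⇔ (≡K-step s)     = incr-⇔-step s
  incr-⇔ (≡K-sym e)      = ⇔.sym (incr-⇔ e)
  incr-⇔ (≡K-trans e e′) = ⇔.trans (incr-⇔ e) (incr-⇔ e′)

  incr-resp-≡K : ∀ {u v m n} → u ≡K v → Incr h m u n → Incr h m v n
  incr-resp-≡K e = Equivalence.to (incr-⇔ e)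

incr-reading-≤ : ∀ {T h m n} → IsTableau T → m < h → Incr h m (reading T) n → n ≤ count 0 h (firstRow T)
incr-reading-≤ []                        _   []  = z≤n
incr-reading-≤ {R ∷ T} {h} (row _ R<T tT) m<h d with incr-split (reading T) m<h d
... | v₀ , n₁ , n₂ , m≤v₀ , v₀<h , d₁ , d₂ , refl = begin
  n₁ + n₂                      ≤⟨ +-mono-≤ n₁≤ (incr-≤-count ≤-refl d₂) ⟩
  count 0 v₀ R + count v₀ h R  ≡⟨ count-split R z≤n (<⇒≤ v₀<h) ⟩
  count 0 h R                  ∎
  where
  open ≤-Reasoning
  n₁≤ : n₁ ≤ count 0 v₀ R
  n₁≤ = ≤-trans (incr-reading-≤ tT (s≤s m≤v₀) d₁) (stacked-count v₀ R<T)

-- rowInsertAll R xs = (final row , word of the bumped letters).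
rowInsertAll : Word → Word → Word × Word
rowInsertAll R []       = R , []
rowInsertAll R (x ∷ xs) with rowInsert R x
... | R′ , nothing = rowInsertAll R′ xs
... | R′ , just y  = map₂ (y ∷_) (rowInsertAll R′ xs)

rowInsertAll-++ : ∀ R xs ys → rowInsertAll R (xs ++ ys) ≡
  (let R′ , b = rowInsertAll R xs in map₂ (b ++_) (rowInsertAll R′ ys))
rowInsertAll-++ R []       ys = refl
rowInsertAll-++ R (x ∷ xs) ys with rowInsert R x
... | R′ , nothing = rowInsertAll-++ R′ xs ys
... | R′ , just y  = cong (map₂ (y ∷_)) (rowInsertAll-++ R′ xs ys)

rowInsertAll-≡K : ∀ R xs → Sorted R → R ++ xs ≡K (let R′ , b = rowInsertAll R xs in b ++ R′)
rowInsertAll-≡K R []       _  = ≡⇒≡K (++-identityʳ R)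
rowInsertAll-≡K R (x ∷ xs) sR with rowInsert R x in eq | rowInsert-sorted R {x} sR
... | R′ , nothing | sR′ = begin
  R ++ x ∷ xs         ≡⟨ ++-assoc R [ x ] xs ⟨
  (R ++ [ x ]) ++ xs  ≡⟨ cong (_++ xs) (rowInsert-appends R eq) ⟨
  R′ ++ xs            ≈⟨ rowInsertAll-≡K R′ xs sR′ ⟩
  _                   ∎
  where open ≡K-Reasoning
... | R′ , just y  | sR′ = begin
  R ++ x ∷ xs         ≡⟨ ++-assoc R [ x ] xs ⟨
  (R ++ [ x ]) ++ xs  ≈⟨ ++⁺ʳ xs (rowInsert-≡K R sR eq) ⟩
  y ∷ R′ ++ xs        ≈⟨ ++⁺ˡ [ y ] (rowInsertAll-≡K R′ xs sR′) ⟩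
  _                   ∎
  where open ≡K-Reasoning

rowInsert-all≤ : ∀ P {x} → All (_≤ x) P → rowInsert P x ≡ (P ++ [ x ] , nothing)
rowInsert-all≤ []      []               = refl
rowInsert-all≤ (p ∷ P) {x} (p≤x ∷ P≤x) with x <? p
... | yes x<p = ⊥-elim (<⇒≱ x<p p≤x)
... | no  _   = cong (map₁ (p ∷_)) (rowInsert-all≤ P P≤x)

rowInsert-bumps-after : ∀ P {x y Q} → All (_≤ x) P → x < y →
                        rowInsert (P ++ y ∷ Q) x ≡ (P ++ x ∷ Q , just y)
rowInsert-bumps-after []      {x} {y} [] x<y with x <? y
... | yes _   = refl
... | no  x≮y = ⊥-elim (x≮y x<y)
rowInsert-bumps-after (p ∷ P) {x} (p≤x ∷ P≤x) x<y with x <? p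
... | yes x<p = ⊥-elim (<⇒≱ x<p p≤x)
... | no  _   = cong (map₁ (p ∷_)) (rowInsert-bumps-after P P≤x x<y)

sorted-++⁻ : ∀ X {Y} → Sorted (X ++ Y) → Sorted X × Sorted Y
sorted-++⁻ []      sY         = [] , sY
sorted-++⁻ (x ∷ X) (x≤ ∷ sXY) = map₁ (Allₚ.++⁻ˡ X x≤ ∷_) (sorted-++⁻ X sXY)

sorted-++-∷⁻ : ∀ P {x X} → Sorted (P ++ x ∷ X) → All (_≤ x) P
sorted-++-∷⁻ []      _          = []
sorted-++-∷⁻ (p ∷ P) (p≤ ∷ sPX) = All.head (Allₚ.++⁻ʳ P p≤) ∷ sorted-++-∷⁻ P sPX

sorted-insert : ∀ X₀ {X₁ a} → Sorted (X₀ ++ X₁) → All (_≤ a) X₀ → All (a ≤_) X₁ →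
                Sorted (X₀ ++ a ∷ X₁)
sorted-insert []       sX₁          []            a≤X₁ = a≤X₁ ∷ sX₁
sorted-insert (x ∷ X₀) (x≤ ∷ sX) (x≤a ∷ X₀≤a) a≤X₁ =
  Allₚ.++⁺ (Allₚ.++⁻ˡ X₀ x≤) (x≤a ∷ Allₚ.++⁻ʳ X₀ x≤) ∷ sorted-insert X₀ sX X₀≤a a≤X₁

stacked-split : ∀ X₀ Y₀ {X₁ Y₁} → length X₀ ≡ length Y₀ → Stacked (X₀ ++ X₁) (Y₀ ++ Y₁) →
                Pointwise _<_ X₀ Y₀ × Stacked X₁ Y₁
stacked-split []       []       _   st          = [] , st
stacked-split (x ∷ X₀) (y ∷ Y₀) len (x<y ∷ st) =
  map₁ (x<y ∷_) (stacked-split X₀ Y₀ (suc-injective len) st)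

rowInsertAll-all≤ : ∀ P X → Sorted (P ++ X) → rowInsertAll P X ≡ (P ++ X , [])
rowInsertAll-all≤ P []      _ = cong (_, []) (≡.sym (++-identityʳ P))
rowInsertAll-all≤ P (x ∷ X) s rewrite rowInsert-all≤ P (sorted-++-∷⁻ P s)
  with rowInsertAll-all≤ (P ++ [ x ]) X (subst Sorted (≡.sym (++-assoc P [ x ] X)) s)
... | ih rewrite ++-assoc P [ x ] X = ih

rowInsertAll-stacked : ∀ P X {Y} → Sorted (P ++ X) → Stacked X Y →
                       rowInsertAll (P ++ Y) X ≡ (P ++ X , Y)
rowInsertAll-stacked P X       s [] rewrite ++-identityʳ P = rowInsertAll-all≤ P X s
rowInsertAll-stacked P (x ∷ X) {y ∷ Y} s (x<y ∷ st)
  rewrite rowInsert-bumps-after P {Q = Y} (sorted-++-∷⁻ P s) x<y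
  with rowInsertAll-stacked (P ++ [ x ]) X (subst Sorted (≡.sym (++-assoc P [ x ] X)) s) st
... | ih rewrite ++-assoc P [ x ] Y | ++-assoc P [ x ] X = cong (map₂ (y ∷_)) ih

rowInsertAll-bumps : ∀ P X {Y Z} → Sorted (P ++ X) → Pointwise _<_ X Y →
                     rowInsertAll (P ++ Y ++ Z) X ≡ (P ++ X ++ Z , Y)
rowInsertAll-bumps P []      s [] = refl
rowInsertAll-bumps P (x ∷ X) {y ∷ Y} {Z} s (x<y ∷ X<Y)
  rewrite rowInsert-bumps-after P {Q = Y ++ Z} (sorted-++-∷⁻ P s) x<y
  with rowInsertAll-bumps (P ++ [ x ]) X {Z = Z} (subst Sorted (≡.sym (++-assoc P [ x ] X)) s) X<Y
... | ih rewrite ++-assoc P [ x ] (Y ++ Z) | ++-assoc P [ x ] (X ++ Z) = cong (map₂ (y ∷_)) ih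

-- The letters of X₀ bump those of Y₀ one by one; then those of X₁, passing over a, bump those of Y₁.
rowInsertAll-splice : ∀ {a} X₀ X₁ Y₀ Y₁ → Sorted (X₀ ++ X₁) → All (_≤ a) X₀ → All (a ≤_) X₁ →
                      Stacked (X₀ ++ X₁) (Y₀ ++ Y₁) → length X₀ ≡ length Y₀ →
                      rowInsertAll (Y₀ ++ a ∷ Y₁) (X₀ ++ X₁) ≡ (X₀ ++ a ∷ X₁ , Y₀ ++ Y₁)
rowInsertAll-splice {a} X₀ X₁ Y₀ Y₁ sX X₀≤a a≤X₁ st len
  rewrite rowInsertAll-++ (Y₀ ++ a ∷ Y₁) X₀ X₁
        | rowInsertAll-bumps [] X₀ {Y₀} {a ∷ Y₁}
            (proj₁ (sorted-++⁻ X₀ sX)) (proj₁ (stacked-split X₀ Y₀ len st))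
        | ≡.sym (++-assoc X₀ [ a ] Y₁)
        | rowInsertAll-stacked (X₀ ++ [ a ]) X₁
            (subst Sorted (≡.sym (++-assoc X₀ [ a ] X₁)) (sorted-insert X₀ sX X₀≤a a≤X₁))
            (proj₂ (stacked-split X₀ Y₀ len st))
        | ++-assoc X₀ [ a ] X₁ = refl

takeBelow : ℕ → Word → Word
takeBelow b []      = []
takeBelow b (x ∷ R) with x <? b
... | yes _ = x ∷ takeBelow b R
... | no  _ = []

dropBelow : ℕ → Word → Word
dropBelow b []      = []
dropBelow b (x ∷ R) with x <? b
... | yes _ = dropBelow b R
... | no  _ = x ∷ R

insertBefore : ℕ → ℕ → Word → Word
insertBefore b a R = takeBelow b R ++ a ∷ dropBelow b R

takeBelow++dropBelow : ∀ b R → takeBelow b R ++ dropBelow b R ≡ R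
takeBelow++dropBelow b []      = refl
takeBelow++dropBelow b (x ∷ R) with x <? b
... | yes _ = cong (x ∷_) (takeBelow++dropBelow b R)
... | no  _ = refl

takeBelow-< : ∀ b R → All (_< b) (takeBelow b R)
takeBelow-< b []      = []
takeBelow-< b (x ∷ R) with x <? b
... | yes x<b = x<b ∷ takeBelow-< b R
... | no  _   = []

dropBelow-≥ : ∀ {b} R → Sorted R → All (b ≤_) (dropBelow b R)
dropBelow-≥         []      _          = []
dropBelow-≥ {b} (x ∷ R) (x≤R ∷ sR) with x <? b
... | yes _   = dropBelow-≥ R sR
... | no  x≮b = ≮⇒≥ x≮b ∷ All.map (≤-trans (≮⇒≥ x≮b)) x≤R

length-takeBelow : ∀ {b} R → Sorted R → length (takeBelow b R) ≡ count 0 b R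
length-takeBelow         []      _          = refl
length-takeBelow {b} (x ∷ R) (x≤R ∷ sR) with x <? b | inRange? 0 b x
... | yes _   | yes _         = cong suc (length-takeBelow R sR)
... | yes x<b | no ∉          = ⊥-elim (∉ (z≤n , x<b))
... | no  x≮b | yes (_ , x<b) = ⊥-elim (x≮b x<b)
... | no  x≮b | no _          = ≡.sym (count-all≥ R (All.map (≤-trans (≮⇒≥ x≮b)) x≤R))

insertBefore-all≥ : ∀ {b a} R → All (b ≤_) R → insertBefore b a R ≡ a ∷ R
insertBefore-all≥     []      _         = refl
insertBefore-all≥ {b} (x ∷ R) (b≤x ∷ _) with x <? b
... | yes x<b = ⊥-elim (<⇒≱ x<b b≤x)
... | no  _   = refl

insertBefore-all< : ∀ {b a} R → All (_< b) R → insertBefore b a R ≡ R ++ [ a ]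
insertBefore-all<     []      []            = refl
insertBefore-all< {b} (x ∷ R) (x<b ∷ R<b) with x <? b
... | yes _   = cong (x ∷_) (insertBefore-all< R R<b)
... | no  x≮b = ⊥-elim (x≮b x<b)

insertBefore-suc : ∀ {a} R → Sorted R → insertBefore a a R ≡ insertBefore (suc a) a R
insertBefore-suc     []      _          = refl
insertBefore-suc {a} (x ∷ R) (x≤R ∷ sR) with x <? a | x <? suc a
... | yes _   | yes _         = cong (x ∷_) (insertBefore-suc R sR)
... | yes x<a | no  x≮1+a     = ⊥-elim (x≮1+a (m≤n⇒m≤1+n x<a))
... | no  _   | no  _         = refl
... | no  x≮a | yes (s≤s x≤a) with ≤-antisym x≤a (≮⇒≥ x≮a)
...   | refl = cong (a ∷_) (≡.trans (≡.sym (insertBefore-all≥ R x≤R)) (insertBefore-suc R sR))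

-- The letters ≤ a of a tableau

-- Shifted a T: the letters ≤ a outside the first row fill exactly the cells above the letters < a.
Shifted : ℕ → Tableau → Set
Shifted a []      = ⊤
Shifted a (R ∷ T) = count 0 a R ≡ count 0 (suc a) (firstRow T) × Shifted a T

count-letter-≤ : ∀ a {T} → IsTableau T → count a (suc a) (reading T) ≤ count 0 (suc a) (firstRow T)
count-letter-≤ a []                     = z≤n
count-letter-≤ a {R ∷ T} (row _ R<T tT) = begin
  count a (suc a) (reading T ++ R)                 ≡⟨ count-++ a (suc a) (reading T) R ⟩
  count a (suc a) (reading T) + count a (suc a) R  ≤⟨ +-monoˡ-≤ _ A≤C ⟩
  count 0 a R + count a (suc a) R                  ≡⟨ count-split R z≤n (n≤1+n a) ⟩
  count 0 (suc a) R                                ∎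
  where
  open ≤-Reasoning
  A≤C : count a (suc a) (reading T) ≤ count 0 a R
  A≤C = ≤-trans (count-letter-≤ a tT) (stacked-count a R<T)

count-letter-≡⇒Shifted : ∀ a {T} → IsTableau T →
  count a (suc a) (reading T) ≡ count 0 (suc a) (firstRow T) → Shifted a T
count-letter-≡⇒Shifted a []                     _  = tt
count-letter-≡⇒Shifted a {R ∷ T} (row _ R<T tT) eq =
  C≡B , count-letter-≡⇒Shifted a tT (≡.trans A≡C C≡B)
  where
  A≡C : count a (suc a) (reading T) ≡ count 0 a R
  A≡C = +-cancelʳ-≡ (count a (suc a) R) _ _ (begin
    count a (suc a) (reading T) + count a (suc a) R  ≡⟨ count-++ a (suc a) (reading T) R ⟨
    count a (suc a) (reading T ++ R)                 ≡⟨ eq ⟩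
    count 0 (suc a) R                                ≡⟨ count-split R z≤n (n≤1+n a) ⟨
    count 0 a R + count a (suc a) R                  ∎)
    where open ≡.≡-Reasoning
  C≡B : count 0 a R ≡ count 0 (suc a) (firstRow T)
  C≡B = ≤-antisym (≤-trans (≤-reflexive (≡.sym A≡C)) (count-letter-≤ a tT)) (stacked-count a R<T)

rowInsertAll-insertBefore : ∀ {a} X Y → Sorted X → Sorted Y → Stacked X Y →
                            count 0 a X ≡ count 0 (suc a) Y →
                            rowInsertAll (insertBefore (suc a) a Y) X ≡ (insertBefore a a X , Y)
rowInsertAll-insertBefore {a} X Y sX sY st eq =
  subst₂ (λ X′ Y′ → rowInsertAll (insertBefore (suc a) a Y) X′ ≡ (insertBefore a a X , Y′))
    (takeBelow++dropBelow a X) (takeBelow++dropBelow (suc a) Y)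
    (rowInsertAll-splice (takeBelow a X) (dropBelow a X) (takeBelow (suc a) Y) (dropBelow (suc a) Y)
      (subst Sorted (≡.sym (takeBelow++dropBelow a X)) sX)
      (All.map <⇒≤ (takeBelow-< a X)) (dropBelow-≥ X sX)
      (subst₂ Stacked (≡.sym (takeBelow++dropBelow a X)) (≡.sym (takeBelow++dropBelow (suc a) Y)) st)
      (≡.trans (length-takeBelow X sX) (≡.trans eq (≡.sym (length-takeBelow Y sY)))))

rowInsertAll-reading : ∀ {a} R T → IsTableau (R ∷ T) → Shifted a (R ∷ T) →
                       rowInsertAll [ a ] (reading (R ∷ T)) ≡ (insertBefore a a R , reading T)
rowInsertAll-reading R [] (row sR st _) (eq , _) = rowInsertAll-insertBefore R [] sR [] st eq
rowInsertAll-reading {a} R (S ∷ T) (row sR st tS@(row sS _ _)) (eq , shS)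
  rewrite rowInsertAll-++ [ a ] (reading (S ∷ T)) R
        | rowInsertAll-reading S T tS shS
        | insertBefore-suc {a} S sS
        | rowInsertAll-insertBefore {a} R S sR sS st eq = refl

shifted-reading-∈C : ∀ {a R T} → IsTableau (R ∷ T) → Shifted a (R ∷ T) → All (_≤ a) R →
                     reading (R ∷ T) ∈C [ a ]
shifted-reading-∈C {a} {R} {T} tab@(row sR _ _) shifted R≤a = begin
  a ∷ reading (R ∷ T)                  ≈⟨ rowInsertAll-≡K [ a ] (reading (R ∷ T)) ([] ∷ []) ⟩
  _                                    ≡⟨ cong (λ (R′ , b) → b ++ R′) (rowInsertAll-reading R T tab shifted) ⟩
  reading T ++ insertBefore a a R      ≡⟨ cong (reading T ++_) (insertBefore-suc R sR) ⟩
  reading T ++ insertBefore (suc a) a R ≡⟨ cong (reading T ++_) (insertBefore-all< R (All.map s≤s R≤a)) ⟩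
  reading T ++ R ++ [ a ]              ≡⟨ ++-assoc (reading T) R [ a ] ⟨
  reading (R ∷ T) ++ [ a ]             ∎
  where open ≡K-Reasoning

-- Roots in the Knuth centralizer

module _ {a k : ℕ} (k>0 : 0 < k) {R T} (tab : IsTableau (R ∷ T))
         (comm : reading (R ∷ T) ∈C (a ^ʷ k)) where

  private
    r : Word
    r = reading (R ∷ T)

    N c : ℕ
    N = count a (suc a) r
    c = count 0 (suc a) R

    sR : Sorted R
    sR = firstRow-sorted tab

  count-letter-≥ : c ≤ N
  count-letter-≥ with incr-replicate-++ k (incr-resp-≡K (≡K-sym comm) long)
    where
    -- the letters ≤ a of R, then a^k
    long : Incr (suc a) 0 (r ++ a ^ʷ k) (c + k)
    long = subst (λ u → Incr (suc a) 0 u (c + k)) (≡.sym (++-assoc (reading T) R (a ^ʷ k)))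
             (incr-++⁺ˡ (reading T) (incr-++ z≤n (n<1+n a) (incr-sorted R sR) (incr-replicate k (n<1+n a))))
  ... | inj₁ d = ⊥-elim (<⇒≱ (m<m+n c k>0) (incr-reading-≤ tab z<s d))
  ... | inj₂ (n₂ , c+k≤k+n₂ , d) = +-cancelʳ-≤ k c N (begin
    c + k   ≤⟨ c+k≤k+n₂ ⟩
    k + n₂  ≤⟨ +-monoʳ-≤ k (incr-≤-count ≤-refl d) ⟩
    k + N   ≡⟨ +-comm k N ⟩
    N + k   ∎)
    where open ≤-Reasoning

  count-letter-≡ : N ≡ c
  count-letter-≡ = ≤-antisym (count-letter-≤ a tab) count-letter-≥

  module _ {e} (a<e : a < e) where

    private
      B : ℕ
      B = count (suc a) (suc e) R

      a<1+e : a < suc e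
      a<1+e = m≤n⇒m≤1+n a<e

      count-first-row-<1+e : count 0 (suc e) R ≡ c + B
      count-first-row-<1+e = ≡.sym (count-split R z≤n a<1+e)

      -- a^k, then the letters a of r, then the letters of R in (a , e]
      long : Incr (suc e) a (a ^ʷ k ++ r) (k + (N + B))
      long = subst (Incr (suc e) a (a ^ʷ k ++ r)) (cong (k +_) length≡)
               (incr-++ ≤-refl a<1+e (incr-replicate k (n<1+n a))
                 (incr-++ ≤-refl a<1+e (incr-letter a (reading T)) (incr-sorted R sR)))
        where
        open ≡.≡-Reasoning
        Nᵀ : ℕ
        Nᵀ = count a (suc a) (reading T)
        length≡ : Nᵀ + count a (suc e) R ≡ N + B
        length≡ = begin
          Nᵀ + count a (suc e) R            ≡⟨ cong (Nᵀ +_) (count-split R (n≤1+n a) a<1+e) ⟨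
          Nᵀ + (count a (suc a) R + B)      ≡⟨ +-assoc Nᵀ (count a (suc a) R) B ⟨
          (Nᵀ + count a (suc a) R) + B      ≡⟨ cong (_+ B) (count-++ a (suc a) (reading T) R) ⟨
          N + B                             ∎

    no-letter-above : e ∈ R → ⊥
    no-letter-above e∈R with incr-++-replicate r a<1+e (incr-resp-≡K comm long)
    ... | inj₁ d = <⇒≱ (m<n+m (N + B) k>0) (begin
      k + (N + B)        ≤⟨ incr-reading-≤ tab a<1+e d ⟩
      count 0 (suc e) R  ≡⟨ count-first-row-<1+e ⟩
      c + B              ≡⟨ cong (_+ B) count-letter-≡ ⟨
      N + B              ∎)
      where open ≤-Reasoning
    ... | inj₂ (n₁ , le , d) =
      <⇒≱ (m<m+n N (count-∈ R a<e (n<1+n e) e∈R)) (+-cancelˡ-≤ k (N + B) N (begin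
      k + (N + B)  ≤⟨ le ⟩
      n₁ + k       ≤⟨ +-monoˡ-≤ k (incr-≤-count ≤-refl d) ⟩
      N + k        ≡⟨ +-comm N k ⟩
      k + N        ∎))
      where open ≤-Reasoning

  first-row-≤ : All (_≤ a) R
  first-row-≤ = All.tabulate letter-≤
    where
    letter-≤ : ∀ {e} → e ∈ R → e ≤ a
    letter-≤ {e} e∈R with e ≤? a
    ... | yes e≤a = e≤a
    ... | no  e≰a = ⊥-elim (no-letter-above (≰⇒> e≰a) e∈R)

  reading-∈C-root⁺ : r ∈C [ a ]
  reading-∈C-root⁺ =
    shifted-reading-∈C tab (count-letter-≡⇒Shifted a tab count-letter-≡) first-row-≤

reading-∈C-root : ∀ {a k T} → 0 < k → IsTableau T → reading T ∈C (a ^ʷ k) → reading T ∈C [ a ]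
reading-∈C-root _   []              _    = ≡K-refl
reading-∈C-root k>0 tab@(row _ _ _) comm = reading-∈C-root⁺ k>0 tab comm

theorem4p2 : ∀ (a k : ℕ) → 0 < a → 0 < k →
    ∀ (w : List ℕ) → All (0 <_) w →
    ((w ∈C (a ^ʷ k) → w ∈C [ a ]) × (w ∈C [ a ] → w ∈C (a ^ʷ k)))
theorem4p2 a k _ k>0 w _ = root , ∈C-replicate k
  where
  w≡P : w ≡K reading (P w)
  w≡P = ≡K-reading-P w
  root : w ∈C (a ^ʷ k) → w ∈C [ a ]
  root w∈C = ∈C-resp-≡K (≡K-sym w≡P) (reading-∈C-root k>0 (P-isTableau w) (∈C-resp-≡K w≡P w∈C))
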